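{- Let $a,n$ be positive integers with $a\geq 3$ and $n\geq 2$. Let $s\geq 2$ and let $e_1,e_2,\ldots,e_s$ be positive integers with $\sum_{i=1}^s e_i=n$. Then $\prod_{i=1}^s(a^{e_i}-1)$ divides $a^n-1$ if and only if either (1) $a=3$, $s=2$, $e_1=e_2=1$; or (2) $a=3$, $s=4$, $e_1=e_2=e_3=e_4=1$. -}

module Defs where

open import Data.Nat using (ℕ; zero; suc; _+_; _*_; _∸_; _^_)
open import Data.Fin using (Fin)
import Data.Fin as F

sumF : (s : ℕ) → (Fin s → ℕ) → ℕ
sumF zero    f = 0
sumF (suc s) f = f F.zero + sumF s (λ i → f (F.suc i))

prodF : (s : ℕ) → (Fin s → ℕ) → ℕ
prodF zero    f = 1
prodF (suc s) f = f F.zero * prodF s (λ i → f (F.suc i))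

{-# OPTIONS --safe #-}
-- Let M be a largest exponent e_i and x = a^M. As a^M − 1 divides a^n − 1, M divides n, and the
-- remaining s − 1 factors, each divisible by a − 1, divide (a^n − 1)/(a^M − 1) = 1 + x + … + x^j
-- with j + 1 ≤ s. For s = 2 this leaves a^M − 1 ∣ a^M + 1, i.e. a = 3 and M = 1. For s ≥ 3,
-- lifting the exponent shows that p^(s−1) ∣ 1 + x + … + x^j forces p^(s−1) ∣ j + 1, which is too
-- small, whenever p is an odd divisor of a − 1, or p = 2 and 4 ∣ x − 1. What survives is a = 3
-- with M odd; then x ≡ 3 (mod 8), the sum has 2-adic valuation 2 + v₂((j + 1)/2), and this
-- forces s = 4, j = 3, every exponent equal to M, and finally M = 1 from 3^M − 1 ∣ 4.
module Submission where

open import Data.Empty using (⊥; ⊥-elim)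
open import Data.Fin using (Fin; punchIn) renaming (zero to fzero; suc to fsuc)
open import Data.Nat
open import Data.Nat.Combinatorics using (_C_; nC1≡n; nCk+nC[k+1]≡[n+1]C[k+1])
open import Data.Nat.Coprimality using (Coprime; coprime-divisor)
open import Data.Nat.Divisibility
open import Data.Nat.DivMod using (_%_; _/_; m≡m%n+[m/n]*n; m%n<n)
open import Data.Nat.Properties
open import Data.Nat.Tactic.RingSolver using (solve-∀)
open import Data.Product using (∃; _×_; _,_; proj₁; proj₂)
open import Data.Sum using (_⊎_; inj₁; inj₂)
import Data.Sum as Sum
open import Function using (_∘_)
open import Function.Bundles using (_⇔_; mk⇔)
open import Relation.Binary.PropositionalEquality
open import Relation.Nullary using (¬_; contradiction; yes; no)
open ≡-Reasoning

open import Defs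

geoSum : ℕ → ℕ → ℕ
geoSum zero    x = 0
geoSum (suc n) x = 1 + x * geoSum n x

suc^≡1+*geoSum : ∀ y n → suc y ^ n ≡ 1 + y * geoSum n (suc y)
suc^≡1+*geoSum y zero    = cong suc (sym (*-zeroʳ y))
suc^≡1+*geoSum y (suc n) = begin
  suc y * suc y ^ n                       ≡⟨ cong (suc y *_) (suc^≡1+*geoSum y n) ⟩
  (1 + y) * (1 + y * geoSum n (suc y))    ≡⟨ lemma y (geoSum n (suc y)) ⟩
  1 + y * geoSum (suc n) (suc y)          ∎
  where
  lemma : ∀ y g → (1 + y) * (1 + y * g) ≡ 1 + y * (1 + (1 + y) * g)
  lemma = solve-∀

suc^∸1≡*geoSum : ∀ y n → suc y ^ n ∸ 1 ≡ y * geoSum n (suc y)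
suc^∸1≡*geoSum y n = cong (_∸ 1) (suc^≡1+*geoSum y n)

geoSum-+ : ∀ m n x → geoSum (m + n) x ≡ geoSum m x + x ^ m * geoSum n x
geoSum-+ zero    n x = sym (+-identityʳ (geoSum n x))
geoSum-+ (suc m) n x = begin
  1 + x * geoSum (m + n) x                  ≡⟨ cong (λ g → 1 + x * g) (geoSum-+ m n x) ⟩
  1 + x * (geoSum m x + x ^ m * geoSum n x) ≡⟨ lemma x (geoSum m x) (x ^ m) (geoSum n x) ⟩
  geoSum (suc m) x + x ^ suc m * geoSum n x ∎
  where
  lemma : ∀ x a b c → 1 + x * (a + b * c) ≡ (1 + x * a) + (x * b) * c
  lemma = solve-∀

geoSum-* : ∀ m n x → geoSum (m * n) x ≡ geoSum m x * geoSum n (x ^ m)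
geoSum-* m zero    x = begin
  geoSum (m * 0) x     ≡⟨ cong (λ k → geoSum k x) (*-zeroʳ m) ⟩
  0                    ≡⟨ *-zeroʳ (geoSum m x) ⟨
  geoSum m x * 0       ∎
geoSum-* m (suc n) x = begin
  geoSum (m * suc n) x                              ≡⟨ cong (λ k → geoSum k x) (*-suc m n) ⟩
  geoSum (m + m * n) x                              ≡⟨ geoSum-+ m (m * n) x ⟩
  geoSum m x + x ^ m * geoSum (m * n) x             ≡⟨ cong (λ g → geoSum m x + x ^ m * g) (geoSum-* m n x) ⟩
  geoSum m x + x ^ m * (geoSum m x * geoSum n (x ^ m)) ≡⟨ lemma (geoSum m x) (x ^ m) (geoSum n (x ^ m)) ⟩
  geoSum m x * geoSum (suc n) (x ^ m)               ∎
  where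
  lemma : ∀ a b c → a + b * (a * c) ≡ a * (1 + b * c)
  lemma = solve-∀

geoSum∣geoSum-* : ∀ m n x → geoSum m x ∣ geoSum (n * m) x
geoSum∣geoSum-* m n x = subst (geoSum m x ∣_)
  (trans (sym (geoSum-* m n x)) (cong (λ k → geoSum k x) (*-comm m n))) (m∣m*n _)

geoSum-mono-< : ∀ x .{{_ : NonZero x}} {m n} → m < n → geoSum m x < geoSum n x
geoSum-mono-< x {m} m<n with m≤n⇒∃[o]m+o≡n m<n
... | k , refl = subst (λ i → geoSum m x < geoSum i x) (+-suc m k)
  (subst (geoSum m x <_) (sym (geoSum-+ m (suc k) x))
    (m<m+n (geoSum m x) (*-mono-≤ (m^n>0 x m) (s≤s z≤n))))

geoSum∣geoSum⇒≡0 : ∀ x .{{_ : NonZero x}} {m r} → r < m → geoSum m x ∣ geoSum r x → r ≡ 0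
geoSum∣geoSum⇒≡0 x {r = zero}  _   _  = refl
geoSum∣geoSum⇒≡0 x {r = suc _} r<m g∣ = contradiction (∣⇒≤ g∣) (<⇒≱ (geoSum-mono-< x r<m))

geoSum∣geoSum⇒∣ : ∀ x .{{_ : NonZero x}} m n → geoSum (suc m) x ∣ geoSum n x → suc m ∣ n
geoSum∣geoSum⇒∣ x m n g∣ =
  m%n≡0⇒n∣m n (suc m) (geoSum∣geoSum⇒≡0 x (m%n<n n (suc m)) (∣m+n∣m⇒∣n g∣sum g∣quotientPart))
  where
  g = geoSum (suc m) x
  r = n % suc m
  g∣sum : g ∣ x ^ r * geoSum (n / suc m * suc m) x + geoSum r x
  g∣sum = subst (g ∣_) (begin
    geoSum n x                                             ≡⟨ cong (λ i → geoSum i x) (m≡m%n+[m/n]*n n (suc m)) ⟩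
    geoSum (r + n / suc m * suc m) x                       ≡⟨ geoSum-+ r _ x ⟩
    geoSum r x + x ^ r * geoSum (n / suc m * suc m) x      ≡⟨ +-comm (geoSum r x) _ ⟩
    x ^ r * geoSum (n / suc m * suc m) x + geoSum r x      ∎) g∣
  g∣quotientPart : g ∣ x ^ r * geoSum (n / suc m * suc m) x
  g∣quotientPart = ∣n⇒∣m*n (x ^ r) (geoSum∣geoSum-* (suc m) (n / suc m) x)

geoSum-1+*-mod : ∀ n q t → ∃ λ r → geoSum n (1 + q * t) ≡ n + q * r
geoSum-1+*-mod zero    q t = 0 , sym (*-zeroʳ q)
geoSum-1+*-mod (suc n) q t with geoSum-1+*-mod n q t
... | r , eq = r + t * n + q * t * r , (begin
  1 + (1 + q * t) * geoSum n (1 + q * t) ≡⟨ cong (λ g → 1 + (1 + q * t) * g) eq ⟩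
  1 + (1 + q * t) * (n + q * r)          ≡⟨ lemma n q t r ⟩
  suc n + q * (r + t * n + q * t * r)    ∎)
  where
  lemma : ∀ n q t r → 1 + (1 + q * t) * (n + q * r) ≡ (1 + n) + q * (r + t * n + q * t * r)
  lemma = solve-∀

∣geoSum⇒∣ : ∀ n q t → q ∣ geoSum n (1 + q * t) → q ∣ n
∣geoSum⇒∣ n q t q∣ with geoSum-1+*-mod n q t
... | r , eq = ∣m+n∣m⇒∣n (subst (q ∣_) (trans eq (+-comm n (q * r))) q∣) (m∣m*n r)

∸1∣geoSum⇒∸1∣ : ∀ n x → 1 ≤ x → x ∸ 1 ∣ geoSum n x → x ∸ 1 ∣ n
∸1∣geoSum⇒∸1∣ n x 1≤x = ∣geoSum⇒∣ n (x ∸ 1) 1 ∘ subst (λ y → x ∸ 1 ∣ geoSum n y) x≡1+[x∸1]*1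
  where
  x≡1+[x∸1]*1 : x ≡ 1 + (x ∸ 1) * 1
  x≡1+[x∸1]*1 = trans (sym (m+[n∸m]≡n 1≤x)) (cong suc (sym (*-identityʳ (x ∸ 1))))

∣∸1⇒≡1+* : ∀ {q x} → 1 ≤ x → q ∣ x ∸ 1 → ∃ λ t → x ≡ 1 + q * t
∣∸1⇒≡1+* {q} 1≤x (divides t eq) = t , trans (sym (m+[n∸m]≡n 1≤x)) (cong suc (trans eq (*-comm t q)))

coprime-1+* : ∀ n k → Coprime n (1 + n * k)
coprime-1+* n k {d} (d∣n , d∣1+nk) =
  ∣1⇒≡1 (∣m+n∣m⇒∣n (subst (d ∣_) (+-comm 1 (n * k)) d∣1+nk) (∣m⇒∣m*n k d∣n))

^-coprime-divisor : ∀ {n m} .{{_ : NonZero n}} → Coprime n m → ∀ c o → n ^ c ∣ m * o → n ^ c ∣ o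
^-coprime-divisor         n⊥m zero    o _  = 1∣ o
^-coprime-divisor {n} {m} n⊥m (suc c) o n^[1+c]∣ with coprime-divisor n⊥m (∣-trans (m∣m*n (n ^ c)) n^[1+c]∣)
... | divides o′ refl = subst (_∣ o′ * n) (*-comm (n ^ c) n)
  (*-monoˡ-∣ n (^-coprime-divisor n⊥m c o′ (*-cancelˡ-∣ n (subst (n * n ^ c ∣_) (lemma m o′ n) n^[1+c]∣))))
  where
  lemma : ∀ m o′ n → m * (o′ * n) ≡ n * (m * o′)
  lemma = solve-∀

suc[n]C2≡n+nC2 : ∀ n → suc n C 2 ≡ n + n C 2
suc[n]C2≡n+nC2 n = trans (sym (nCk+nC[k+1]≡[n+1]C[k+1] n 1)) (cong (_+ n C 2) (nC1≡n n))

geoSum-1+-mod-square : ∀ n z → ∃ λ r → geoSum n (1 + z) ≡ n + (n C 2) * z + z * z * r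
geoSum-1+-mod-square zero    z = 0 , sym (*-zeroʳ (z * z))
geoSum-1+-mod-square (suc n) z with geoSum-1+-mod-square n z
... | r , eq = r′ , (begin
  1 + (1 + z) * geoSum n (1 + z)               ≡⟨ cong (λ g → 1 + (1 + z) * g) eq ⟩
  1 + (1 + z) * (n + (n C 2) * z + z * z * r)  ≡⟨ lemma n (n C 2) z r ⟩
  suc n + (n + n C 2) * z + z * z * r′         ≡⟨ cong (λ c → suc n + c * z + z * z * r′) (suc[n]C2≡n+nC2 n) ⟨
  suc n + (suc n C 2) * z + z * z * r′         ∎)
  where
  r′ = n C 2 + r + z * r
  lemma : ∀ n c z r → 1 + (1 + z) * (n + c * z + z * z * r) ≡ (1 + n) + (n + c) * z + z * z * (c + r + z * r)
  lemma = solve-∀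

[1+2h]C2≡[1+2h]*h : ∀ h → (1 + 2 * h) C 2 ≡ (1 + 2 * h) * h
[1+2h]C2≡[1+2h]*h zero    = refl
[1+2h]C2≡[1+2h]*h (suc h) = begin
  (1 + 2 * suc h) C 2         ≡⟨ cong (_C 2) (lemma₁ h) ⟩
  suc (suc d) C 2             ≡⟨ suc[n]C2≡n+nC2 (suc d) ⟩
  suc d + suc d C 2           ≡⟨ cong (suc d +_) (suc[n]C2≡n+nC2 d) ⟩
  suc d + (d + d C 2)         ≡⟨ cong (λ c → suc d + (d + c)) ([1+2h]C2≡[1+2h]*h h) ⟩
  suc d + (d + d * h)         ≡⟨ lemma₂ h ⟩
  (1 + 2 * suc h) * suc h     ∎
  where
  d = 1 + 2 * h
  lemma₁ : ∀ h → 1 + 2 * suc h ≡ suc (suc (1 + 2 * h))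
  lemma₁ = solve-∀
  lemma₂ : ∀ h → suc (1 + 2 * h) + (1 + 2 * h + (1 + 2 * h) * h) ≡ (1 + 2 * suc h) * suc h
  lemma₂ = solve-∀

geoSum-odd : ∀ h t → let d = 1 + 2 * h in ∃ λ w → geoSum d (1 + d * t) ≡ d * (1 + d * w)
geoSum-odd h t with geoSum-1+-mod-square (1 + 2 * h) ((1 + 2 * h) * t)
... | r , eq = h * t + t * t * r , (begin
  geoSum d (1 + d * t)                              ≡⟨ eq ⟩
  d + (d C 2) * (d * t) + d * t * (d * t) * r       ≡⟨ cong (λ c → d + c * (d * t) + d * t * (d * t) * r)
                                                              ([1+2h]C2≡[1+2h]*h h) ⟩
  d + d * h * (d * t) + d * t * (d * t) * r         ≡⟨ lemma d h t r ⟩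
  d * (1 + d * (h * t + t * t * r))                 ∎)
  where
  d = 1 + 2 * h
  lemma : ∀ d h t r → d + d * h * (d * t) + d * t * (d * t) * r ≡ d * (1 + d * (h * t + t * t * r))
  lemma = solve-∀

geoSum-two : ∀ t → ∃ λ w → geoSum 2 (1 + 4 * t) ≡ 2 * (1 + 2 * w)
geoSum-two t = t , lemma t
  where
  lemma : ∀ t → 1 + (1 + 4 * t) * (1 + (1 + 4 * t) * 0) ≡ 2 * (1 + 2 * t)
  lemma = solve-∀

-- Lifting the exponent: geoSum (p * n′) x = geoSum p x * geoSum n′ (x ^ p), where the first
-- factor is p times a number prime to p and x ^ p is again ≡ 1 modulo q.
module _ {p q} .{{_ : NonZero p}} (p∣q : p ∣ q)
         (geoSum-p : ∀ t → ∃ λ w → geoSum p (1 + q * t) ≡ p * (1 + p * w)) where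

  p∣geoSum⇒p∣ : ∀ n t → p ∣ geoSum n (1 + q * t) → p ∣ n
  p∣geoSum⇒p∣ n t = ∣geoSum⇒∣ n p (quotient p∣q * t) ∘ subst (λ y → p ∣ geoSum n (1 + y)) q*t≡
    where
    q*t≡ : q * t ≡ p * (quotient p∣q * t)
    q*t≡ = trans (cong (_* t) (m∣n⇒n≡m*quotient p∣q)) (*-assoc p _ t)

  ^∣geoSum⇒^∣ : ∀ c n t → p ^ c ∣ geoSum n (1 + q * t) → p ^ c ∣ n
  ^∣geoSum⇒^∣ zero    n t _ = 1∣ n
  ^∣geoSum⇒^∣ (suc c) n t p^[1+c]∣ with p∣geoSum⇒p∣ n t (∣-trans (m∣m*n (p ^ c)) p^[1+c]∣) | geoSum-p t
  ... | divides n′ refl | w , geoSum-p≡ = subst (_∣ n′ * p) (*-comm (p ^ c) p)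
    (*-monoˡ-∣ p (^∣geoSum⇒^∣ c n′ t′
      (^-coprime-divisor (coprime-1+* p w) c _ (*-cancelˡ-∣ p (subst (p * p ^ c ∣_) geoSum[n′p]≡ p^[1+c]∣)))))
    where
    x = 1 + q * t
    t′ = t * geoSum p x
    x^p≡ : x ^ p ≡ 1 + q * t′
    x^p≡ = trans (suc^≡1+*geoSum (q * t) p) (cong suc (*-assoc q t (geoSum p x)))
    geoSum[n′p]≡ : geoSum (n′ * p) x ≡ p * ((1 + p * w) * geoSum n′ (1 + q * t′))
    geoSum[n′p]≡ = begin
      geoSum (n′ * p) x                           ≡⟨ cong (λ k → geoSum k x) (*-comm n′ p) ⟩
      geoSum (p * n′) x                           ≡⟨ geoSum-* p n′ x ⟩
      geoSum p x * geoSum n′ (x ^ p)              ≡⟨ cong₂ (λ g y → g * geoSum n′ y) geoSum-p≡ x^p≡ ⟩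
      p * (1 + p * w) * geoSum n′ (1 + q * t′)    ≡⟨ *-assoc p _ _ ⟩
      p * ((1 + p * w) * geoSum n′ (1 + q * t′))  ∎

sumF-punchIn : ∀ s (f : Fin (suc s) → ℕ) i → sumF (suc s) f ≡ f i + sumF s (f ∘ punchIn i)
sumF-punchIn s       f fzero    = refl
sumF-punchIn (suc s) f (fsuc i) = begin
  f fzero + sumF (suc s) (f ∘ fsuc)                      ≡⟨ cong (f fzero +_) (sumF-punchIn s (f ∘ fsuc) i) ⟩
  f fzero + (f (fsuc i) + sumF s (f ∘ fsuc ∘ punchIn i)) ≡⟨ +-comm-middle (f fzero) (f (fsuc i)) _ ⟩
  f (fsuc i) + (f fzero + sumF s (f ∘ fsuc ∘ punchIn i)) ∎
  where
  +-comm-middle : ∀ x y z → x + (y + z) ≡ y + (x + z)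
  +-comm-middle = solve-∀

prodF-punchIn : ∀ s (f : Fin (suc s) → ℕ) i → prodF (suc s) f ≡ f i * prodF s (f ∘ punchIn i)
prodF-punchIn s       f fzero    = refl
prodF-punchIn (suc s) f (fsuc i) = begin
  f fzero * prodF (suc s) (f ∘ fsuc)                      ≡⟨ cong (f fzero *_) (prodF-punchIn s (f ∘ fsuc) i) ⟩
  f fzero * (f (fsuc i) * prodF s (f ∘ fsuc ∘ punchIn i)) ≡⟨ *-comm-middle (f fzero) (f (fsuc i)) _ ⟩
  f (fsuc i) * (f fzero * prodF s (f ∘ fsuc ∘ punchIn i)) ∎
  where
  *-comm-middle : ∀ x y z → x * (y * z) ≡ y * (x * z)
  *-comm-middle = solve-∀

∃-argmax : ∀ s (f : Fin (suc s) → ℕ) → ∃ λ i → ∀ k → f k ≤ f i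
∃-argmax zero    f = fzero , λ { fzero → ≤-refl }
∃-argmax (suc s) f with ∃-argmax s (f ∘ fsuc)
... | i , f≤fᵢ with f fzero ≤? f (fsuc i)
...   | yes f₀≤ = fsuc i , λ { fzero → f₀≤ ; (fsuc k) → f≤fᵢ k }
...   | no  f₀≰ = fzero  , λ { fzero → ≤-refl ; (fsuc k) → ≤-trans (f≤fᵢ k) (≰⇒≥ f₀≰) }

sumF-≤ : ∀ s (f : Fin s → ℕ) {B} → (∀ k → f k ≤ B) → sumF s f ≤ s * B
sumF-≤ zero    f f≤B = z≤n
sumF-≤ (suc s) f f≤B = +-mono-≤ (f≤B fzero) (sumF-≤ s (f ∘ fsuc) (f≤B ∘ fsuc))

sumF≡*⇒≡ : ∀ s (f : Fin s → ℕ) {B} → (∀ k → f k ≤ B) → sumF s f ≡ s * B → ∀ k → f k ≡ B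
sumF≡*⇒≡ zero    f f≤B Σ≡ ()
sumF≡*⇒≡ (suc s) f {B} f≤B Σ≡ = λ
  { fzero    → f0≡B
  ; (fsuc k) → sumF≡*⇒≡ s (f ∘ fsuc) (f≤B ∘ fsuc) rest≡ k
  }
  where
  B≤f0 : B ≤ f fzero
  B≤f0 = +-cancelʳ-≤ (s * B) B (f fzero)
    (subst (_≤ f fzero + s * B) Σ≡ (+-monoʳ-≤ (f fzero) (sumF-≤ s (f ∘ fsuc) (f≤B ∘ fsuc))))
  f0≡B : f fzero ≡ B
  f0≡B = ≤-antisym (f≤B fzero) B≤f0
  rest≡ : sumF s (f ∘ fsuc) ≡ s * B
  rest≡ = +-cancelˡ-≡ B _ _ (trans (cong (_+ sumF s (f ∘ fsuc)) (sym f0≡B)) Σ≡)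

^∣prodF : ∀ s (f : Fin s → ℕ) {d} → (∀ k → d ∣ f k) → d ^ s ∣ prodF s f
^∣prodF zero    f d∣ = ∣-refl
^∣prodF (suc s) f d∣ = *-pres-∣ (d∣ fzero) (^∣prodF s (f ∘ fsuc) (d∣ ∘ fsuc))

cofactor∣geoSum : ∀ Y .{{_ : NonZero Y}} m n P →
                  (suc Y ^ suc m ∸ 1) * P ∣ suc Y ^ (suc m + n) ∸ 1 →
                  ∃ λ j → n ≡ j * suc m × P ∣ geoSum (suc j) (suc Y ^ suc m)
cofactor∣geoSum Y m n P ∣^∸1 = j , n≡j*M , P∣
  where
  a = suc Y
  M = suc m
  g = geoSum M a
  g*P∣ : g * P ∣ geoSum (M + n) a
  g*P∣ = *-cancelˡ-∣ Y (subst₂ _∣_ (trans (cong (_* P) (suc^∸1≡*geoSum Y M)) (*-assoc Y g P))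
                                  (suc^∸1≡*geoSum Y (M + n)) ∣^∸1)
  M∣n : M ∣ n
  M∣n = ∣m+n∣m⇒∣n (geoSum∣geoSum⇒∣ a m (M + n) (m*n∣⇒m∣ g P g*P∣)) ∣-refl
  j = quotient M∣n
  n≡j*M : n ≡ j * M
  n≡j*M = m∣n⇒n≡quotient*m M∣n
  geoSum[M+n]≡ : geoSum (M + n) a ≡ g * geoSum (suc j) (a ^ M)
  geoSum[M+n]≡ = begin
    geoSum (M + n) a                ≡⟨ cong (λ k → geoSum (M + k) a) n≡j*M ⟩
    geoSum (suc j * M) a            ≡⟨ cong (λ k → geoSum k a) (*-comm (suc j) M) ⟩
    geoSum (M * suc j) a            ≡⟨ geoSum-* M (suc j) a ⟩
    g * geoSum (suc j) (a ^ M)      ∎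
  P∣ : P ∣ geoSum (suc j) (a ^ M)
  P∣ = *-cancelˡ-∣ g (subst (g * P ∣_) geoSum[M+n]≡ g*P∣)

prodPow∸1 : ℕ → (s : ℕ) → (Fin s → ℕ) → ℕ
prodPow∸1 a s e = prodF s (λ i → a ^ e i ∸ 1)

∣pred⇒∣^∸1 : ∀ {d Y} r → d ∣ Y → d ∣ suc Y ^ r ∸ 1
∣pred⇒∣^∸1 {d} {Y} r d∣Y = subst (d ∣_) (sym (suc^∸1≡*geoSum Y r)) (∣m⇒∣m*n _ d∣Y)

∣pred⇒^∣prodPow∸1 : ∀ {d Y} s (R : Fin s → ℕ) → d ∣ Y → d ^ s ∣ prodPow∸1 (suc Y) s R
∣pred⇒^∣prodPow∸1 s R d∣Y = ^∣prodF s _ (λ k → ∣pred⇒∣^∸1 (R k) d∣Y)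

saturated⇒^∸1∣ : ∀ a s (R : Fin (suc s) → ℕ) {M} → 1 ≤ a ^ M →
                 (∀ k → R k ≤ M) → sumF (suc s) R ≡ suc s * M →
                 prodPow∸1 a (suc s) R ∣ geoSum (suc (suc s)) (a ^ M) → a ^ M ∸ 1 ∣ suc (suc s)
saturated⇒^∸1∣ a s R {M} 1≤a^M R≤M ΣR≡ P∣ =
  ∸1∣geoSum⇒∸1∣ (suc (suc s)) (a ^ M) 1≤a^M (∣-trans a^M∸1∣P P∣)
  where
  a^M∸1∣P : a ^ M ∸ 1 ∣ prodPow∸1 a (suc s) R
  a^M∸1∣P = subst (λ r → a ^ r ∸ 1 ∣ prodPow∸1 a (suc s) R) (sumF≡*⇒≡ (suc s) R R≤M ΣR≡ fzero) (m∣m*n _)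

4+n≤2^[2+n] : ∀ n → 4 + n ≤ 2 ^ (2 + n)
4+n≤2^[2+n] zero    = ≤-refl
4+n≤2^[2+n] (suc n) = ≤-trans (subst (5 + n ≤_) (lemma n) (m≤m+n (5 + n) (3 + n))) (*-monoʳ-≤ 2 (4+n≤2^[2+n] n))
  where
  lemma : ∀ n → 5 + n + (3 + n) ≡ 2 * (4 + n)
  lemma = solve-∀

9≤^ : ∀ {a} M → 3 ≤ a → 2 ≤ M → 9 ≤ a ^ M
9≤^ {a} M 3≤a 2≤M =
  ≤-trans (*-mono-≤ 3≤a (*-mono-≤ 3≤a (≤-refl {1}))) (^-monoʳ-≤ a {{>-nonZero (≤-trans (s≤s z≤n) 3≤a)}} 2≤M)

^∸1≤7⇒≡1 : ∀ {a} M → 3 ≤ a → 1 ≤ M → a ^ M ∸ 1 ≤ 7 → M ≡ 1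
^∸1≤7⇒≡1 (suc zero)    _   _ _  = refl
^∸1≤7⇒≡1 (suc (suc m)) 3≤a _ ≤7 =
  contradiction (≤-trans (∸-monoˡ-≤ 1 (9≤^ (2 + m) 3≤a (s≤s (s≤s z≤n)))) ≤7) (<-irrefl refl)

even⊎odd : ∀ n → ∃ λ k → (n ≡ 2 * k) ⊎ (n ≡ 1 + 2 * k)
even⊎odd zero    = 0 , inj₁ refl
even⊎odd (suc n) with even⊎odd n
... | k , inj₁ refl = k , inj₂ refl
... | k , inj₂ refl = suc k , inj₁ (lemma k)
  where
  lemma : ∀ k → 2 + 2 * k ≡ 2 * (1 + k)
  lemma = solve-∀

odd∣⊎4∣⊎≡2 : ∀ {Y} → 2 ≤ Y → (∃ λ h → 1 + 2 * suc h ∣ Y) ⊎ 4 ∣ Y ⊎ Y ≡ 2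
odd∣⊎4∣⊎≡2 {Y} 2≤Y with even⊎odd Y
... | zero  , inj₂ refl = contradiction 2≤Y λ { (s≤s ()) }
... | suc h , inj₂ refl = inj₁ (h , ∣-refl)
... | k     , inj₁ refl with even⊎odd k
...   | k′    , inj₁ refl = inj₂ (inj₁ (divides k′ (lemma k′)))
  where
  lemma : ∀ k → 2 * (2 * k) ≡ k * 4
  lemma = solve-∀
...   | zero  , inj₂ refl = inj₂ (inj₂ refl)
...   | suc h , inj₂ refl = inj₁ (h , n∣m*n 2)

^∣geoSum⇒^∣-odd : ∀ h {x} c n → 1 ≤ x → 1 + 2 * h ∣ x ∸ 1 →
                  (1 + 2 * h) ^ c ∣ geoSum n x → (1 + 2 * h) ^ c ∣ n
^∣geoSum⇒^∣-odd h c n 1≤x d∣x∸1 with ∣∸1⇒≡1+* 1≤x d∣x∸1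
... | t , refl = ^∣geoSum⇒^∣ ∣-refl (geoSum-odd h) c n t

^∣geoSum⇒^∣-two : ∀ {x} c n → 1 ≤ x → 4 ∣ x ∸ 1 → 2 ^ c ∣ geoSum n x → 2 ^ c ∣ n
^∣geoSum⇒^∣-two c n 1≤x 4∣x∸1 with ∣∸1⇒≡1+* 1≤x 4∣x∸1
... | t , refl = ^∣geoSum⇒^∣ (divides 2 refl) geoSum-two c n t

^∣suc≤⇒⊥ : ∀ {d c j} → 2 ≤ d → j ≤ 2 + c → d ^ (2 + c) ∣ suc j → ⊥
^∣suc≤⇒⊥ {d} {c} 2≤d j≤ d^∣ = contradiction
  (≤-trans (≤-trans (4+n≤2^[2+n] c) (^-monoˡ-≤ (2 + c) 2≤d)) (∣⇒≤ d^∣)) (<⇒≱ (s≤s (s≤s j≤)))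

3^[2h]≡1+8*geoSum : ∀ h → 3 ^ (2 * h) ≡ 1 + 8 * geoSum h 9
3^[2h]≡1+8*geoSum h = trans (sym (^-*-assoc 3 2 h)) (suc^≡1+*geoSum 8 h)

8∣3^[2h]∸1 : ∀ h → 8 ∣ 3 ^ (2 * h) ∸ 1
8∣3^[2h]∸1 h = subst (8 ∣_) (cong (_∸ 1) (sym (3^[2h]≡1+8*geoSum h))) (m∣m*n (geoSum h 9))

3^[1+2h]≡3+8* : ∀ h → 3 ^ (1 + 2 * h) ≡ 3 + 8 * (3 * geoSum h 9)
3^[1+2h]≡3+8* h = trans (cong (3 *_) (3^[2h]≡1+8*geoSum h)) (lemma (geoSum h 9))
  where
  lemma : ∀ g → 3 * (1 + 8 * g) ≡ 3 + 8 * (3 * g)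
  lemma = solve-∀

16∣prodPow∸1 : ∀ (R : Fin 2 → ℕ) h → sumF 2 R ≡ 1 + 2 * h → 16 ∣ prodPow∸1 3 2 R
16∣prodPow∸1 R h ΣR≡ with even⊎odd (R fzero) | even⊎odd (R (fsuc fzero))
... | k , inj₁ R₀≡ | _ =
  *-pres-∣ (subst (λ r → 8 ∣ 3 ^ r ∸ 1) (sym R₀≡) (8∣3^[2h]∸1 k)) (∣m⇒∣m*n 1 (∣pred⇒∣^∸1 (R (fsuc fzero)) ∣-refl))
... | _ | k , inj₁ R₁≡ =
  *-pres-∣ (∣pred⇒∣^∸1 (R fzero) (∣-refl {2})) (∣m⇒∣m*n 1 (subst (λ r → 8 ∣ 3 ^ r ∸ 1) (sym R₁≡) (8∣3^[2h]∸1 k)))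
... | k , inj₂ R₀≡ | k′ , inj₂ R₁≡ = contradiction (begin
  2 * (1 + k + k′)                  ≡⟨ lemma k k′ ⟩
  (1 + 2 * k) + ((1 + 2 * k′) + 0)  ≡⟨ cong₂ (λ r₀ r₁ → r₀ + (r₁ + 0)) R₀≡ R₁≡ ⟨
  sumF 2 R                          ≡⟨ ΣR≡ ⟩
  1 + 2 * h                         ∎) (even≢odd (1 + k + k′) h)
  where
  lemma : ∀ k k′ → 2 * (1 + k + k′) ≡ (1 + 2 * k) + ((1 + 2 * k′) + 0)
  lemma = solve-∀

-- geoSum (2 * N) x = (1 + x) * geoSum N (x ^ 2), with 1 + x = 4 * odd and x ^ 2 ≡ 1 (mod 8).
2^[2+c]∣geoSum⇒ : ∀ {y} u c n → y ≡ 3 + 8 * u → 2 ^ (2 + c) ∣ geoSum n y → ∃ λ N → n ≡ N * 2 × 2 ^ c ∣ N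
2^[2+c]∣geoSum⇒ u c n refl 2^[2+c]∣ = N , n≡N*2 ,
  ^∣geoSum⇒^∣ (divides 2 refl) geoSum-two c N t
    (^-coprime-divisor (coprime-1+* 2 u) c _ (*-cancelˡ-∣ 2 (*-cancelˡ-∣ 2 (subst (2 ^ (2 + c) ∣_) geoSum[N*2]≡ 2^[2+c]∣geoSum[N*2]))))
  where
  x = 3 + 8 * u
  x≡1+2* : ∀ u → 3 + 8 * u ≡ 1 + 2 * (1 + 4 * u)
  x≡1+2* = solve-∀
  2∣n : 2 ∣ n
  2∣n = ∣geoSum⇒∣ n 2 (1 + 4 * u) (subst (λ y → 2 ∣ geoSum n y) (x≡1+2* u) (∣-trans (m∣m*n (2 ^ (1 + c))) 2^[2+c]∣))
  N = quotient 2∣n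
  n≡N*2 : n ≡ N * 2
  n≡N*2 = m∣n⇒n≡quotient*m 2∣n
  2^[2+c]∣geoSum[N*2] : 2 ^ (2 + c) ∣ geoSum (N * 2) x
  2^[2+c]∣geoSum[N*2] = subst (λ k → 2 ^ (2 + c) ∣ geoSum k x) n≡N*2 2^[2+c]∣
  t = 2 + 12 * u + 16 * (u * u)
  geoSum[N*2]≡ : geoSum (N * 2) x ≡ 2 * (2 * ((1 + 2 * u) * geoSum N (1 + 4 * t)))
  geoSum[N*2]≡ = begin
    geoSum (N * 2) x                                ≡⟨ cong (λ k → geoSum k x) (*-comm N 2) ⟩
    geoSum (2 * N) x                                ≡⟨ geoSum-* 2 N x ⟩
    geoSum 2 x * geoSum N (x ^ 2)                   ≡⟨ cong₂ (λ g y → g * geoSum N y) (geoSum2≡ u) (x²≡ u) ⟩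
    2 * (2 * (1 + 2 * u)) * geoSum N (1 + 4 * t)    ≡⟨ lemma (1 + 2 * u) (geoSum N (1 + 4 * t)) ⟩
    2 * (2 * ((1 + 2 * u) * geoSum N (1 + 4 * t)))  ∎
    where
    geoSum2≡ : ∀ u → 1 + (3 + 8 * u) * (1 + (3 + 8 * u) * 0) ≡ 2 * (2 * (1 + 2 * u))
    geoSum2≡ = solve-∀
    x²≡ : ∀ u → (3 + 8 * u) * ((3 + 8 * u) * 1) ≡ 1 + 4 * (2 + 12 * u + 16 * (u * u))
    x²≡ = solve-∀
    lemma : ∀ v g → 2 * (2 * v) * g ≡ 2 * (2 * (v * g))
    lemma = solve-∀

oddExponentCase-halved : ∀ h c j (R : Fin (2 + c) → ℕ) → (∀ k → R k ≤ 1 + 2 * h) → sumF (2 + c) R ≡ j * (1 + 2 * h) →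
                         j ≤ 2 + c → prodPow∸1 3 (2 + c) R ∣ geoSum (suc j) (3 ^ (1 + 2 * h)) →
                         (∃ λ N → suc j ≡ N * 2 × 2 ^ c ∣ N) → 1 + 2 * h ≡ 1 × c ≡ 1
oddExponentCase-halved h c j R R≤M ΣR≡ j≤ P∣ (zero , () , _)
oddExponentCase-halved h zero .1 R R≤M ΣR≡ j≤ P∣ (suc zero , refl , _) =
  ⊥-elim (¬4∣N (2^[2+c]∣geoSum⇒ (3 * geoSum h 9) 2 2 (3^[1+2h]≡3+8* h) (∣-trans 16∣P P∣)))
  where
  16∣P : 16 ∣ prodPow∸1 3 2 R
  16∣P = 16∣prodPow∸1 R h (trans ΣR≡ (*-identityˡ _))
  ¬4∣N : ¬ (∃ λ N → 2 ≡ N * 2 × 2 ^ 2 ∣ N)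
  ¬4∣N (suc zero , refl , 4∣1) = contradiction (∣⇒≤ 4∣1) λ { (s≤s ()) }
oddExponentCase-halved h zero j R R≤M ΣR≡ (s≤s (s≤s ())) P∣ (suc (suc N) , refl , _)
oddExponentCase-halved h (suc zero) .1 R R≤M ΣR≡ j≤ P∣ (suc zero , refl , 2∣1) =
  contradiction (∣⇒≤ 2∣1) λ { (s≤s ()) }
oddExponentCase-halved h (suc zero) .3 R R≤M ΣR≡ j≤ P∣ (suc (suc zero) , refl , _) = M≡1 , refl
  where
  3^M∸1≤4 : 3 ^ (1 + 2 * h) ∸ 1 ≤ 4
  3^M∸1≤4 = ∣⇒≤ (saturated⇒^∸1∣ 3 2 R (m^n>0 3 (1 + 2 * h)) R≤M ΣR≡ P∣)
  M≡1 : 1 + 2 * h ≡ 1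
  M≡1 = ^∸1≤7⇒≡1 (1 + 2 * h) ≤-refl (s≤s z≤n) (≤-trans 3^M∸1≤4 (s≤s (s≤s (s≤s (s≤s z≤n)))))
oddExponentCase-halved h (suc zero) j R R≤M ΣR≡ (s≤s (s≤s (s≤s ()))) P∣ (suc (suc (suc N)) , refl , _)
oddExponentCase-halved h (suc (suc c)) j R R≤M ΣR≡ j≤ P∣ (N@(suc _) , suc[j]≡ , 2^[2+c]∣N) = contradiction
  (≤-trans (*-monoˡ-≤ 2 (≤-trans (4+n≤2^[2+n] c) (∣⇒≤ 2^[2+c]∣N))) (≤-trans (≤-reflexive (sym suc[j]≡)) (s≤s j≤)))
  (<⇒≱ (subst (6 + c ≤_) (lemma c) (m≤m+n (6 + c) (2 + c))))
  where
  lemma : ∀ c → 6 + c + (2 + c) ≡ (4 + c) * 2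
  lemma = solve-∀

oddExponentCase : ∀ h c j (R : Fin (2 + c) → ℕ) → (∀ k → R k ≤ 1 + 2 * h) → sumF (2 + c) R ≡ j * (1 + 2 * h) →
                  j ≤ 2 + c → prodPow∸1 3 (2 + c) R ∣ geoSum (suc j) (3 ^ (1 + 2 * h)) → 1 + 2 * h ≡ 1 × c ≡ 1
oddExponentCase h c j R R≤M ΣR≡ j≤ P∣ = oddExponentCase-halved h c j R R≤M ΣR≡ j≤ P∣
  (2^[2+c]∣geoSum⇒ (3 * geoSum h 9) c (suc j) (3^[1+2h]≡3+8* h) (∣-trans (∣pred⇒^∣prodPow∸1 (2 + c) R ∣-refl) P∣))

liftingBound⇒⊥ : ∀ {Y c j d} M (R : Fin (2 + c) → ℕ) → 2 ≤ d → d ∣ Y → j ≤ 2 + c →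
                 (d ^ (2 + c) ∣ geoSum (suc j) (suc Y ^ M) → d ^ (2 + c) ∣ suc j) →
                 prodPow∸1 (suc Y) (2 + c) R ∣ geoSum (suc j) (suc Y ^ M) → ⊥
liftingBound⇒⊥ M R 2≤d d∣Y j≤ lifting P∣ = ^∣suc≤⇒⊥ 2≤d j≤ (lifting (∣-trans (∣pred⇒^∣prodPow∸1 _ R d∣Y) P∣))

manyFactors : ∀ Y M c j (R : Fin (2 + c) → ℕ) → 2 ≤ Y → (∀ k → R k ≤ M) → sumF (2 + c) R ≡ j * M → j ≤ 2 + c →
              prodPow∸1 (suc Y) (2 + c) R ∣ geoSum (suc j) (suc Y ^ M) → Y ≡ 2 × M ≡ 1 × c ≡ 1
manyFactors Y M c j R 2≤Y R≤M ΣR≡ j≤ P∣ with odd∣⊎4∣⊎≡2 2≤Y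
... | inj₁ (h , d∣Y) = ⊥-elim (liftingBound⇒⊥ M R (s≤s (s≤s z≤n)) d∣Y j≤
  (^∣geoSum⇒^∣-odd (suc h) (2 + c) (suc j) (m^n>0 (suc Y) M) (∣pred⇒∣^∸1 M d∣Y)) P∣)
... | inj₂ (inj₁ 4∣Y) = ⊥-elim (liftingBound⇒⊥ M R ≤-refl (∣-trans (divides 2 refl) 4∣Y) j≤
  (^∣geoSum⇒^∣-two (2 + c) (suc j) (m^n>0 (suc Y) M) (∣pred⇒∣^∸1 M 4∣Y)) P∣)
... | inj₂ (inj₂ refl) with even⊎odd M
...   | h , inj₁ refl = ⊥-elim (liftingBound⇒⊥ (2 * h) R ≤-refl ∣-refl j≤
  (^∣geoSum⇒^∣-two (2 + c) (suc j) (m^n>0 3 (2 * h)) (∣-trans (divides 2 refl) (8∣3^[2h]∸1 h))) P∣)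
...   | h , inj₂ refl = refl , oddExponentCase h c j R R≤M ΣR≡ j≤ P∣

singleFactor : ∀ Y M j (R : Fin 1 → ℕ) → 2 ≤ Y → (∀ k → 1 ≤ R k) → (∀ k → R k ≤ M) → sumF 1 R ≡ j * M → j ≤ 1 →
               prodPow∸1 (suc Y) 1 R ∣ geoSum (suc j) (suc Y ^ M) → Y ≡ 2 × M ≡ 1
singleFactor Y M zero R 2≤Y 1≤R R≤M ΣR≡ j≤ P∣ =
  contradiction (subst (1 ≤_) (trans (sym (+-identityʳ (R fzero))) ΣR≡) (1≤R fzero)) λ ()
singleFactor Y M (suc zero) R 2≤Y 1≤R R≤M ΣR≡ j≤ P∣ = Y≡2 , M≡1
  where
  a^M∸1≤2 : suc Y ^ M ∸ 1 ≤ 2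
  a^M∸1≤2 = ∣⇒≤ (saturated⇒^∸1∣ (suc Y) 0 R (m^n>0 (suc Y) M) R≤M ΣR≡ P∣)
  M≡1 : M ≡ 1
  M≡1 = ^∸1≤7⇒≡1 M (s≤s 2≤Y) (≤-trans (1≤R fzero) (R≤M fzero)) (≤-trans a^M∸1≤2 (s≤s (s≤s z≤n)))
  Y≡2 : Y ≡ 2
  Y≡2 = ≤-antisym (subst (_≤ 2) (*-identityʳ Y) (subst (λ m → suc Y ^ m ∸ 1 ≤ 2) M≡1 a^M∸1≤2)) 2≤Y
singleFactor Y M (suc (suc j)) R 2≤Y 1≤R R≤M ΣR≡ (s≤s ()) P∣

reducedCases : ∀ Y M s j (R : Fin s → ℕ) → 2 ≤ Y → 1 ≤ s → (∀ k → 1 ≤ R k) → (∀ k → R k ≤ M) → sumF s R ≡ j * M →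
               j ≤ s → prodPow∸1 (suc Y) s R ∣ geoSum (suc j) (suc Y ^ M) → Y ≡ 2 × M ≡ 1 × (s ≡ 1 ⊎ s ≡ 3)
reducedCases Y M 1 j R 2≤Y _ 1≤R R≤M ΣR≡ j≤ P∣ with singleFactor Y M j R 2≤Y 1≤R R≤M ΣR≡ j≤ P∣
... | Y≡2 , M≡1 = Y≡2 , M≡1 , inj₁ refl
reducedCases Y M (suc (suc c)) j R 2≤Y _ _ R≤M ΣR≡ j≤ P∣ with manyFactors Y M c j R 2≤Y R≤M ΣR≡ j≤ P∣
... | Y≡2 , M≡1 , refl = Y≡2 , M≡1 , inj₂ refl

divisibility⇒exceptional : ∀ Y s (e : Fin (suc s) → ℕ) → 2 ≤ Y → 1 ≤ s → (∀ i → 1 ≤ e i) →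
                           prodPow∸1 (suc Y) (suc s) e ∣ suc Y ^ sumF (suc s) e ∸ 1 →
                           Y ≡ 2 × (s ≡ 1 ⊎ s ≡ 3) × (∀ i → e i ≡ 1)
divisibility⇒exceptional Y@(suc _) s e 2≤Y 1≤s 1≤e P∣ = Y≡2 , s≡1⊎s≡3 , eₖ≡1
  where
  a = suc Y
  i = proj₁ (∃-argmax s e)
  eₖ≤eᵢ : ∀ k → e k ≤ e i
  eₖ≤eᵢ = proj₂ (∃-argmax s e)
  m = pred (e i)
  M = suc m
  eᵢ≡M : e i ≡ M
  eᵢ≡M = sym (suc-pred (e i) {{>-nonZero (1≤e i)}})
  R = e ∘ punchIn i
  R≤M : ∀ k → R k ≤ M
  R≤M k = subst (R k ≤_) eᵢ≡M (eₖ≤eᵢ (punchIn i k))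
  split : (a ^ M ∸ 1) * prodPow∸1 a s R ∣ a ^ (M + sumF s R) ∸ 1
  split = subst₂ (λ p n → p ∣ a ^ n ∸ 1)
    (trans (prodF-punchIn s (λ k → a ^ e k ∸ 1) i) (cong (λ r → (a ^ r ∸ 1) * prodPow∸1 a s R) eᵢ≡M))
    (trans (sumF-punchIn s e i) (cong (_+ sumF s R) eᵢ≡M)) P∣
  reduced = cofactor∣geoSum Y m (sumF s R) (prodPow∸1 a s R) split
  j = proj₁ reduced
  ΣR≡j*M : sumF s R ≡ j * M
  ΣR≡j*M = proj₁ (proj₂ reduced)
  j≤s : j ≤ s
  j≤s = *-cancelʳ-≤ j s M (subst (_≤ s * M) ΣR≡j*M (sumF-≤ s R R≤M))
  conclusion = reducedCases Y M s j R 2≤Y 1≤s (1≤e ∘ punchIn i) R≤M ΣR≡j*M j≤s (proj₂ (proj₂ reduced))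
  Y≡2 = proj₁ conclusion
  s≡1⊎s≡3 = proj₂ (proj₂ conclusion)
  eₖ≡1 : ∀ k → e k ≡ 1
  eₖ≡1 k = ≤-antisym (subst (e k ≤_) (trans eᵢ≡M (proj₁ (proj₂ conclusion))) (eₖ≤eᵢ k)) (1≤e k)

exceptional⇒divisibility : ∀ a s (e : Fin s → ℕ) →
                           (a ≡ 3 × s ≡ 2 × (∀ i → e i ≡ 1)) ⊎ (a ≡ 3 × s ≡ 4 × (∀ i → e i ≡ 1)) →
                           prodPow∸1 a s e ∣ a ^ sumF s e ∸ 1
exceptional⇒divisibility .3 .2 e (inj₁ (refl , refl , e≡1))
  rewrite e≡1 fzero | e≡1 (fsuc fzero) = divides 2 refl
exceptional⇒divisibility .3 .4 e (inj₂ (refl , refl , e≡1))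
  rewrite e≡1 fzero | e≡1 (fsuc fzero) | e≡1 (fsuc (fsuc fzero)) | e≡1 (fsuc (fsuc (fsuc fzero))) = divides 5 refl

proposition3p1 : (a n s : ℕ) → 3 ≤ a → 2 ≤ n → 2 ≤ s
    → (e : Fin s → ℕ) → (∀ i → 1 ≤ e i) → sumF s e ≡ n
    → (prodF s (λ i → a ^ e i ∸ 1) ∣ a ^ n ∸ 1)
      ⇔ ((a ≡ 3 × s ≡ 2 × (∀ i → e i ≡ 1)) ⊎ (a ≡ 3 × s ≡ 4 × (∀ i → e i ≡ 1)))
proposition3p1 (suc Y) _ (suc s) (s≤s 2≤Y) _ (s≤s 1≤s) e 1≤e refl =
  mk⇔ divisibility⇒cases (exceptional⇒divisibility (suc Y) (suc s) e)
  where
  divisibility⇒cases : prodPow∸1 (suc Y) (suc s) e ∣ suc Y ^ sumF (suc s) e ∸ 1 →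
                       (suc Y ≡ 3 × suc s ≡ 2 × (∀ i → e i ≡ 1)) ⊎ (suc Y ≡ 3 × suc s ≡ 4 × (∀ i → e i ≡ 1))
  divisibility⇒cases P∣ with divisibility⇒exceptional Y s e 2≤Y 1≤s 1≤e P∣
  ... | Y≡2 , s≡1⊎s≡3 , e≡1 = Sum.map (λ s≡1 → cong suc Y≡2 , cong suc s≡1 , e≡1) (λ s≡3 → cong suc Y≡2 , cong suc s≡3 , e≡1) s≡1⊎s≡3
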